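{- Let $a, b$ be relatively prime positive integers such that $\frac{5}{4} < \frac{a}{b} < \frac{4}{3}$. Then the $a$-uniform morphism $\varphi$ on $\mathbb{Z}_{\geq 0}$ defined by $\varphi(n) = 0^{5 a - 6 b - 1} \, 1 \, 0^{ -2 a + 3 b - 1} \, 1 \, 0^{ -2 a + 3 b - 1} \, (n+2)$ locates words of length $3 a - 3 b$ and is $\frac{a}{b}$-power-free.
   Context: Words are indexed from position $0$; a factor is a contiguous subword; $c^m$ denotes $m$ copies of the letter $c$. For relatively prime positive integers $a,b$ and a nonempty word $v$ whose length is divisible by $b$, define $v^{a/b} = v^{\lfloor a/b \rfloor} v_0 v_1 \cdots v_{t-1}$, where $t = |v|\,(a/b - \lfloor a/b\rfloor)$; such a word is called an $\frac{a}{b}$-power. A word is $\frac{a}{b}$-power-free if none of its factors is an $\frac{a}{b}$-power. A morphism $\varphi$ on an alphabet $\Sigma$ is a map $\Sigma \to \Sigma^*$, extended to words by concatenation; it is $k$-uniform if all images have length $k$. A morphism is $\frac{a}{b}$-power-free if $\varphi(w)$ is $\frac{a}{b}$-power-free for every finite $\frac{a}{b}$-power-free word $w$. A $k$-uniform morphism $\varphi$ on $\Sigma$ locates words of length $\ell$ if for each word $x$ of length $\ell$ there is an integer $j$ such that, for all $w \in \Sigma^*$, every occurrence of $x$ as a factor of $\varphi(w)$ begins at a position congruent to $j$ modulo $k$. -}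

module Defs where

open import Data.Nat using (ℕ; suc; _+_; _*_; _∸_; _≤_; _<_; NonZero)
open import Data.Nat.DivMod using (_/_; _%_)
open import Data.Nat.Divisibility using (_∣_)
open import Data.List using (List; []; _∷_; _++_; length; replicate; concat; concatMap; take)
open import Data.Product using (Σ; ∃; _×_; _,_)
open import Relation.Binary.PropositionalEquality using (_≡_; _≢_)
open import Relation.Nullary using (¬_)

-- Words over the alphabet ℤ≥0 (= ℕ), indexed from position 0.
Word : Set
Word = List ℕ

_^ᶜ_ : ℕ → ℕ → Word
c ^ᶜ m = replicate m c

-- v^{a/b} = v^{⌊a/b⌋} v_0 ⋯ v_{t-1},  t = |v| (a/b - ⌊a/b⌋) = (|v|/b)·(a mod b)
-- (meaningful when b ∣ |v|)
fracPow : (a b : ℕ) → .{{NonZero b}} → Word → Word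
fracPow a b v = concat (replicate (a / b) v) ++ take ((length v / b) * (a % b)) v

IsPower : (a b : ℕ) → .{{NonZero b}} → Word → Set
IsPower a b w = Σ Word λ v → (v ≢ []) × (b ∣ length v) × (w ≡ fracPow a b v)

Factor : Word → Word → Set
Factor x u = Σ Word λ p → Σ Word λ s → u ≡ p ++ x ++ s

PowerFree : (a b : ℕ) → .{{NonZero b}} → Word → Set
PowerFree a b w = ∀ x → Factor x w → ¬ IsPower a b x

Morphism : Set
Morphism = ℕ → Word

apply : Morphism → Word → Word
apply φ w = concatMap φ w

Uniform : ℕ → Morphism → Set
Uniform k φ = ∀ n → length (φ n) ≡ k

MorphismPowerFree : (a b : ℕ) → .{{NonZero b}} → Morphism → Set
MorphismPowerFree a b φ = ∀ w → PowerFree a b w → PowerFree a b (apply φ w)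

-- the k-uniform morphism φ locates words of length ℓ:
-- for each x with |x| = ℓ there is j such that every occurrence of x in any φ(w)
-- (i.e. φ(w) = p x s, occurrence starting at position |p|) has |p| ≡ j (mod k)
Locates : (k : ℕ) → .{{NonZero k}} → Morphism → ℕ → Set
Locates k φ ℓ = ∀ x → length x ≡ ℓ →
  ∃ λ j → ∀ w p s → apply φ w ≡ p ++ x ++ s → length p % k ≡ j % k

φab : ℕ → ℕ → Morphism
φab a b n = (0 ^ᶜ (5 * a ∸ 6 * b ∸ 1)) ++ (1 ∷ [])
  ++ (0 ^ᶜ (3 * b ∸ 2 * a ∸ 1)) ++ (1 ∷ [])
  ++ (0 ^ᶜ (3 * b ∸ 2 * a ∸ 1)) ++ (n + 2 ∷ [])

-- With d = a - b the hypothesis reads 3d < b < 4d; module Pattern parametrises these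
-- pairs as d = E + g + 2, b = 3d + E + 1.  Replacing every letter ≥ 2 by 2, every image
-- looks like a prefix of (0^A 1 0^B 1 0^B 2)^ω, so the kind of the letter at position m
-- depends only on m mod a, and its nonzero letters (marks) sit at A, A₁ and Z = a - 1.
-- • Locating: L consecutive kinds determine the residue mod a (window-residue);
--   a decision over the finitely many residues then yields the required j.
-- • Power-freeness: as a = b + d with d < b, an a/b-power is a word of length k·a whose
--   first k·d letters recur k·b positions later (OneAndAFraction).  For k = 1, 2 the
--   kinds would repeat with period d or 2d, impossible since marks are less than 2d
--   apart but equal marks never are d or 2d apart (no-repetition).  For k ≥ 3 the
--   repetition covers L letters, so a ∣ k·b, hence a ∣ k, and the last letters of the
--   blocks met by the power, which record the preimage, form a power in the preimage.
module Submission where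

open import Defs
open import Data.Nat using (ℕ; zero; suc; _+_; _*_; _∸_; _≤_; _<_; _≤?_; _<?_; _≟_; z≤n; s≤s; NonZero)
open import Data.Nat.Properties
open import Data.Nat.DivMod
open import Data.Nat.Divisibility using (_∣_; divides; m%n≡0⇒n∣m)
open import Data.Nat.Coprimality using (Coprime; coprime-divisor)
open import Data.Nat.Tactic.RingSolver using (solve-∀)
open import Data.List using ([]; _∷_; _++_; length; replicate; take; drop; map; concat)
open import Data.List.Properties
  using (length-++; length-take; length-drop; take++drop≡id; ++-identityʳ; concatMap-cong)
open import Data.Fin using (Fin; toℕ; fromℕ<)
open import Data.Fin.Properties using (any?; all?; toℕ-fromℕ<; toℕ<n)
open import Data.Product using (∃; ∃₂; _×_; _,_; proj₁; proj₂)
open import Data.Sum using (_⊎_; inj₁; inj₂)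
open import Data.Empty using (⊥; ⊥-elim)
open import Relation.Nullary using (¬_; yes; no)
open import Relation.Binary.Definitions using (tri<; tri≈; tri>)
open import Relation.Binary.PropositionalEquality
  using (_≡_; _≢_; refl; sym; trans; cong; cong₂; subst; subst₂; module ≡-Reasoning)

-- The letter of a word at position i (0 beyond the end).
infixl 9 _!_
_!_ : Word → ℕ → ℕ
[] ! _ = 0
(x ∷ xs) ! zero = x
(x ∷ xs) ! suc i = xs ! i

!-++ˡ : ∀ xs ys {i} → i < length xs → (xs ++ ys) ! i ≡ xs ! i
!-++ˡ (x ∷ xs) ys {zero} _ = refl
!-++ˡ (x ∷ xs) ys {suc i} (s≤s i<) = !-++ˡ xs ys i<

!-++ʳ : ∀ xs ys i → (xs ++ ys) ! (length xs + i) ≡ ys ! i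
!-++ʳ [] ys i = refl
!-++ʳ (x ∷ xs) ys i = !-++ʳ xs ys i

!-take : ∀ n xs {i} → i < n → take n xs ! i ≡ xs ! i
!-take (suc n) [] _ = refl
!-take (suc n) (x ∷ xs) {zero} _ = refl
!-take (suc n) (x ∷ xs) {suc i} (s≤s i<n) = !-take n xs i<n

!-drop : ∀ n xs i → drop n xs ! i ≡ xs ! (n + i)
!-drop zero xs i = refl
!-drop (suc n) [] i = refl
!-drop (suc n) (x ∷ xs) i = !-drop n xs i

!-map : ∀ f → f 0 ≡ 0 → ∀ xs i → f (xs ! i) ≡ map f xs ! i
!-map f f0 [] i = f0
!-map f f0 (x ∷ xs) zero = refl
!-map f f0 (x ∷ xs) (suc i) = !-map f f0 xs i

!-ext : ∀ xs ys → length xs ≡ length ys → (∀ i → i < length xs → xs ! i ≡ ys ! i) → xs ≡ ys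
!-ext [] [] _ _ = refl
!-ext (x ∷ xs) (y ∷ ys) eq agree =
  cong₂ _∷_ (agree 0 (s≤s z≤n)) (!-ext xs ys (suc-injective eq) (λ i i< → agree (suc i) (s≤s i<)))

length-take≤ : ∀ n (xs : Word) → n ≤ length xs → length (take n xs) ≡ n
length-take≤ n xs n≤ = trans (length-take n xs) (m≤n⇒m⊓n≡m n≤)

occurrence-! : ∀ {u : Word} p x s → u ≡ p ++ x ++ s → ∀ {i} → i < length x → u ! (length p + i) ≡ x ! i
occurrence-! p x s refl {i} i< = trans (!-++ʳ p (x ++ s) i) (!-++ˡ x s i<)

occurrence-length : ∀ {u : Word} p x s → u ≡ p ++ x ++ s → length p + length x ≤ length u
occurrence-length p x s refl = begin
  length p + length x              ≤⟨ +-monoʳ-≤ (length p) (m≤m+n (length x) (length s)) ⟩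
  length p + (length x + length s) ≡⟨ cong (length p +_) (sym (length-++ x)) ⟩
  length p + length (x ++ s)       ≡⟨ sym (length-++ p) ⟩
  length (p ++ x ++ s)             ∎
  where open ≤-Reasoning

window-factor : ∀ J n w → Factor (take n (drop J w)) w
window-factor J n w = take J w , drop n (drop J w) ,
  trans (sym (take++drop≡id J w)) (cong (take J w ++_) (sym (take++drop≡id n (drop J w))))

length-window : ∀ J n w → J + n ≤ length w → length (take n (drop J w)) ≡ n
length-window J n w J+n≤ = length-take≤ n (drop J w)
  (subst (n ≤_) (sym (length-drop J w)) (subst (_≤ length w ∸ J) (m+n∸m≡n J n) (∸-monoˡ-≤ J J+n≤)))

!-window : ∀ J n w {i} → i < n → take n (drop J w) ! i ≡ w ! (J + i)
!-window J n w {i} i<n = trans (!-take n (drop J w) i<n) (!-drop J w i)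

<-witness : ∀ {m n} k → m + suc k ≡ n → m < n
<-witness {m} k refl = m<m+n m (s≤s z≤n)

%-shift : ∀ m k n .{{_ : NonZero n}} → (m + k) % n ≡ (m % n + k) % n
%-shift m k n = begin
  (m + k) % n               ≡⟨ %-distribˡ-+ m k n ⟩
  (m % n + k % n) % n       ≡⟨ cong (λ r → (r + k % n) % n) (sym (m%n%n≡m%n m n)) ⟩
  (m % n % n + k % n) % n   ≡⟨ sym (%-distribˡ-+ (m % n) k n) ⟩
  (m % n + k) % n           ∎
  where open ≡-Reasoning

-- Adding i and then the complement n ∸ i % n adds a multiple of n.
%-undo-shift : ∀ x i n .{{_ : NonZero n}} → x % n ≡ ((x + i) % n + (n ∸ i % n)) % n
%-undo-shift x i n = begin
  x % n                                   ≡⟨ sym ([m+kn]%n≡m%n x (suc (i / n)) n) ⟩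
  (x + suc (i / n) * n) % n               ≡⟨ cong (λ t → (x + t) % n) i+c≡ ⟩
  (x + (i + (n ∸ i % n))) % n             ≡⟨ cong (_% n) (sym (+-assoc x i _)) ⟩
  (x + i + (n ∸ i % n)) % n               ≡⟨ %-shift (x + i) (n ∸ i % n) n ⟩
  ((x + i) % n + (n ∸ i % n)) % n         ∎
  where
    open ≡-Reasoning
    i+c≡ : suc (i / n) * n ≡ i + (n ∸ i % n)
    i+c≡ = begin
      suc (i / n) * n                 ≡⟨ +-comm n (i / n * n) ⟩
      i / n * n + n                   ≡⟨ cong (i / n * n +_) (sym (m+[n∸m]≡n (m%n≤n i n))) ⟩
      i / n * n + (i % n + (n ∸ i % n)) ≡⟨ rearrange (i / n * n) (i % n) (n ∸ i % n) ⟩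
      i % n + i / n * n + (n ∸ i % n)   ≡⟨ cong (_+ (n ∸ i % n)) (sym (m≡m%n+[m/n]*n i n)) ⟩
      i + (n ∸ i % n)                   ∎
      where
        rearrange : ∀ x y z → x + (y + z) ≡ y + x + z
        rearrange = solve-∀

%-cancelʳ-+ : ∀ x y i n .{{_ : NonZero n}} → (x + i) % n ≡ (y + i) % n → x % n ≡ y % n
%-cancelʳ-+ x y i n eq =
  trans (%-undo-shift x i n) (trans (cong (λ r → (r + (n ∸ i % n)) % n) eq) (sym (%-undo-shift y i n)))

residue-cancel : ∀ {x y} i n .{{_ : NonZero n}} → x < n → y < n → (x + i) % n ≡ (y + i) % n → x ≡ y
residue-cancel {x} {y} i n x<n y<n eq =
  trans (sym (m<n⇒m%n≡m x<n)) (trans (%-cancelʳ-+ x y i n eq) (m<n⇒m%n≡m y<n))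

module _ {k : ℕ} {φ : Morphism} (uniform : Uniform k φ) where

  apply-length : ∀ w → length (apply φ w) ≡ length w * k
  apply-length [] = refl
  apply-length (x ∷ w) = trans (length-++ (φ x)) (cong₂ _+_ (uniform x) (apply-length w))

  apply-! : ∀ w j {r} → r < k → j * k + r < length w * k → apply φ w ! (j * k + r) ≡ φ (w ! j) ! r
  apply-! (x ∷ w) zero r<k _ = !-++ˡ (φ x) (apply φ w) (subst (_ <_) (sym (uniform x)) r<k)
  apply-! (x ∷ w) (suc j) {r} r<k bound = begin
    apply φ (x ∷ w) ! (k + j * k + r)              ≡⟨ cong (λ t → apply φ (x ∷ w) ! t) shift ⟩
    apply φ (x ∷ w) ! (length (φ x) + (j * k + r)) ≡⟨ !-++ʳ (φ x) (apply φ w) (j * k + r) ⟩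
    apply φ w ! (j * k + r)                        ≡⟨ apply-! w j r<k bound′ ⟩
    φ (w ! j) ! r                                  ∎
    where
      open ≡-Reasoning
      shift : k + j * k + r ≡ length (φ x) + (j * k + r)
      shift = trans (+-assoc k (j * k) r) (cong (_+ (j * k + r)) (sym (uniform x)))
      bound′ : j * k + r < length w * k
      bound′ = +-cancelˡ-< k _ _ (subst (_< k + length w * k) (+-assoc k (j * k) r) bound)

  apply-!-residue : .{{_ : NonZero k}} → ∀ w {m} → m < length w * k →
                    apply φ w ! m ≡ φ (w ! (m / k)) ! (m % k)
  apply-!-residue w {m} m< =
    trans (cong (apply φ w !_) m≡) (apply-! w (m / k) (m%n<n m k) (subst (_< length w * k) m≡ m<))
    where
      m≡ : m ≡ m / k * k + m % k
      m≡ = trans (m≡m%n+[m/n]*n m k) (+-comm (m % k) _)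

HasPeriod : ℕ → ℕ → Word → Set
HasPeriod p n x = ∀ i → i < n → x ! i ≡ x ! (p + i)

module OneAndAFraction (a b d : ℕ) .{{_ : NonZero b}} (a≡b+d : a ≡ b + d) (d<b : d < b) where

  a/b≡1 : a / b ≡ 1
  a/b≡1 = begin
    a / b             ≡⟨ m/n≡1+[m∸n]/n (subst (b ≤_) (sym a≡b+d) (m≤m+n b d)) ⟩
    1 + (a ∸ b) / b   ≡⟨ cong (λ t → 1 + (t ∸ b) / b) a≡b+d ⟩
    1 + (b + d ∸ b) / b ≡⟨ cong (λ t → 1 + t / b) (m+n∸m≡n b d) ⟩
    1 + d / b         ≡⟨ cong (1 +_) (m<n⇒m/n≡0 d<b) ⟩
    1                 ∎
    where open ≡-Reasoning

  a%b≡d : a % b ≡ d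
  a%b≡d = trans (cong (_% b) (trans a≡b+d (+-comm b d))) (trans ([m+n]%n≡m%n d b) (m<n⇒m%n≡m d<b))

  ka≡kb+kd : ∀ k → k * a ≡ k * b + k * d
  ka≡kb+kd k = trans (cong (k *_) a≡b+d) (*-distribˡ-+ k b d)

  kd≤kb : ∀ k → k * d ≤ k * b
  kd≤kb k = *-monoʳ-≤ k (<⇒≤ d<b)

  length-take-kd : ∀ v k → length v ≡ k * b → length (take (k * d) v) ≡ k * d
  length-take-kd v k |v| = length-take≤ (k * d) v (subst (k * d ≤_) (sym |v|) (kd≤kb k))

  fracPow-shape : ∀ v k → length v ≡ k * b → fracPow a b v ≡ v ++ take (k * d) v
  fracPow-shape v k |v| = cong₂ _++_
    (trans (cong (λ t → concat (replicate t v)) a/b≡1) (++-identityʳ v))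
    (cong (λ t → take t v) (cong₂ _*_ (trans (cong (_/ b) |v|) (m*n/n≡m k b)) a%b≡d))

  power⇒periodic : ∀ {x} → IsPower a b x →
                   ∃ λ k → k ≢ 0 × length x ≡ k * a × HasPeriod (k * b) (k * d) x
  power⇒periodic {x} (v , v≢[] , divides k |v| , refl) = k , k≢0 , |x| , period
    where
      x≡ : fracPow a b v ≡ v ++ take (k * d) v
      x≡ = fracPow-shape v k |v|
      k≢0 : k ≢ 0
      k≢0 refl = v≢[] (length-0 v |v|)
        where
          length-0 : ∀ (v : Word) → length v ≡ 0 → v ≡ []
          length-0 [] _ = refl
      |x| : length (fracPow a b v) ≡ k * a
      |x| = begin
        length (fracPow a b v)             ≡⟨ cong length x≡ ⟩
        length (v ++ take (k * d) v)       ≡⟨ length-++ v ⟩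
        length v + length (take (k * d) v) ≡⟨ cong₂ _+_ |v| (length-take-kd v k |v|) ⟩
        k * b + k * d                      ≡⟨ sym (ka≡kb+kd k) ⟩
        k * a                              ∎
        where open ≡-Reasoning
      period : HasPeriod (k * b) (k * d) (fracPow a b v)
      period i i<kd = begin
        fracPow a b v ! i                        ≡⟨ cong (_! i) x≡ ⟩
        (v ++ take (k * d) v) ! i
          ≡⟨ !-++ˡ v _ (subst (i <_) (sym |v|) (<-≤-trans i<kd (kd≤kb k))) ⟩
        v ! i                                    ≡⟨ sym (!-take (k * d) v i<kd) ⟩
        take (k * d) v ! i                       ≡⟨ sym (!-++ʳ v (take (k * d) v) i) ⟩
        (v ++ take (k * d) v) ! (length v + i)   ≡⟨ cong₂ (λ y t → y ! (t + i)) (sym x≡) |v| ⟩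
        fracPow a b v ! (k * b + i)              ∎
        where open ≡-Reasoning

  periodic⇒power : ∀ {x} k → k ≢ 0 → length x ≡ k * a → HasPeriod (k * b) (k * d) x → IsPower a b x
  periodic⇒power {x} k k≢0 |x| period = v , v≢[] , divides k |v| , trans x≡ (sym (fracPow-shape v k |v|))
    where
      v : Word
      v = take (k * b) x
      |v| : length v ≡ k * b
      |v| = length-take≤ (k * b) x (subst (k * b ≤_) (sym (trans |x| (ka≡kb+kd k))) (m≤m+n (k * b) (k * d)))
      v≢[] : v ≢ []
      v≢[] v≡[] = k≢0 (m*n≡0⇒m≡0 k b (trans (sym |v|) (cong length v≡[])))
      x≡ : x ≡ v ++ take (k * d) v
      x≡ = !-ext x (v ++ take (k * d) v) lengths letters
        where
          lengths : length x ≡ length (v ++ take (k * d) v)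
          lengths = trans |x| (trans (ka≡kb+kd k) (sym (trans (length-++ v) (cong₂ _+_ |v| (length-take-kd v k |v|)))))
          letters : ∀ i → i < length x → x ! i ≡ (v ++ take (k * d) v) ! i
          letters i i<|x| with i <? k * b
          ... | yes i<kb = sym (trans (!-++ˡ v _ (subst (i <_) (sym |v|) i<kb)) (!-take (k * b) x i<kb))
          ... | no i≮kb with m≤n⇒∃[o]m+o≡n (≮⇒≥ i≮kb)
          ...   | j , refl = begin
                  x ! (k * b + j)                          ≡⟨ sym (period j j<kd) ⟩
                  x ! j                                    ≡⟨ sym (!-take (k * b) x (<-≤-trans j<kd (kd≤kb k))) ⟩
                  v ! j                                    ≡⟨ sym (!-take (k * d) v j<kd) ⟩
                  take (k * d) v ! j                       ≡⟨ sym (!-++ʳ v _ j) ⟩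
                  (v ++ take (k * d) v) ! (length v + j)   ≡⟨ cong (λ t → (v ++ take (k * d) v) ! (t + j)) |v| ⟩
                  (v ++ take (k * d) v) ! (k * b + j)      ∎
            where
              open ≡-Reasoning
              j<kd : j < k * d
              j<kd = +-cancelˡ-< (k * b) j (k * d) (subst (k * b + j <_) (trans |x| (ka≡kb+kd k)) i<|x|)

kind : ℕ → ℕ
kind 0 = 0
kind 1 = 1
kind (suc (suc _)) = 2

!-at-block : ∀ m c ys → ((0 ^ᶜ m) ++ c ∷ ys) ! m ≡ c
!-at-block zero c ys = refl
!-at-block (suc m) c ys = !-at-block m c ys

!-past-block : ∀ m c ys i → ((0 ^ᶜ m) ++ c ∷ ys) ! (suc m + i) ≡ ys ! i
!-past-block zero c ys i = refl
!-past-block (suc m) c ys i = !-past-block m c ys i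

length-block : ∀ m c ys → length ((0 ^ᶜ m) ++ c ∷ ys) ≡ suc m + length ys
length-block zero c ys = refl
length-block (suc m) c ys = cong suc (length-block m c ys)

map-kind-block : ∀ m c ys → map kind ((0 ^ᶜ m) ++ c ∷ ys) ≡ (0 ^ᶜ m) ++ kind c ∷ map kind ys
map-kind-block zero c ys = refl
map-kind-block (suc m) c ys = cong (0 ∷_) (map-kind-block m c ys)

block-nonzero : ∀ m c ys r → ((0 ^ᶜ m) ++ c ∷ ys) ! r ≢ 0 →
                r ≡ m ⊎ ∃ λ r′ → r ≡ suc m + r′ × ys ! r′ ≢ 0
block-nonzero zero c ys zero _ = inj₁ refl
block-nonzero zero c ys (suc r) nz = inj₂ (r , refl , nz)
block-nonzero (suc m) c ys zero nz = ⊥-elim (nz refl)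
block-nonzero (suc m) c ys (suc r) nz with block-nonzero m c ys r nz
... | inj₁ r≡m = inj₁ (cong suc r≡m)
... | inj₂ (r′ , r≡ , nz′) = inj₂ (r′ , cong suc r≡ , nz′)

-- The morphism, for d = a - b written as d = E + g + 2 and b = 3d + E + 1; these are
-- exactly the pairs with 5/4 < a/b < 4/3, i.e. 3d < b < 4d.  Its image of n is
-- 0^A 1 0^B 1 0^B (n+2), with marks (nonzero letters) at positions A, A₁ and Z = a - 1.
module Pattern (E g : ℕ) where

  d b a A B A₁ Z L : ℕ
  d = suc (suc (E + g))
  b = 3 * d + suc E
  a = b + d
  A = d + g
  B = d + E
  A₁ = suc A + B
  Z = suc A + (suc B + B)
  L = 3 * d

  ψ : Morphism
  ψ n = (0 ^ᶜ A) ++ (1 ∷ []) ++ (0 ^ᶜ B) ++ (1 ∷ []) ++ (0 ^ᶜ B) ++ (n + 2 ∷ [])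

  a≡1+Z : a ≡ suc Z
  a≡1+Z = lemma E g
    where
      lemma : ∀ E g → let d = suc (suc (E + g)) in
              3 * d + suc E + d ≡ suc (suc (d + g) + (suc (d + E) + (d + E)))
      lemma = solve-∀

  ψ-uniform : Uniform a ψ
  ψ-uniform n = begin
    length (ψ n)                       ≡⟨ length-block A 1 _ ⟩
    suc A + length ((0 ^ᶜ B) ++ 1 ∷ _) ≡⟨ cong (suc A +_) (length-block B 1 _) ⟩
    suc A + (suc B + length ((0 ^ᶜ B) ++ n + 2 ∷ []))
      ≡⟨ cong (λ t → suc A + (suc B + t)) (length-block B (n + 2) []) ⟩
    suc A + (suc B + (suc B + 0))      ≡⟨ lemma A B ⟩
    suc Z                              ≡⟨ sym a≡1+Z ⟩
    a                                  ∎
    where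
      open ≡-Reasoning
      lemma : ∀ A B → suc A + (suc B + (suc B + 0)) ≡ suc (suc A + (suc B + B))
      lemma = solve-∀

  shape : ℕ → ℕ
  shape r = ψ 0 ! r

  kind-ψ : ∀ n r → kind (ψ n ! r) ≡ shape r
  kind-ψ n r = trans (!-map kind refl (ψ n) r) (cong (_! r) kinds)
    where
      kinds : map kind (ψ n) ≡ ψ 0
      kinds = begin
        map kind (ψ n)  ≡⟨ map-kind-block A 1 _ ⟩
        (0 ^ᶜ A) ++ 1 ∷ map kind ((0 ^ᶜ B) ++ 1 ∷ (0 ^ᶜ B) ++ n + 2 ∷ [])
          ≡⟨ cong (λ t → (0 ^ᶜ A) ++ 1 ∷ t) (map-kind-block B 1 _) ⟩
        (0 ^ᶜ A) ++ 1 ∷ (0 ^ᶜ B) ++ 1 ∷ map kind ((0 ^ᶜ B) ++ n + 2 ∷ [])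
          ≡⟨ cong (λ t → (0 ^ᶜ A) ++ 1 ∷ (0 ^ᶜ B) ++ 1 ∷ t) (map-kind-block B (n + 2) []) ⟩
        (0 ^ᶜ A) ++ 1 ∷ (0 ^ᶜ B) ++ 1 ∷ (0 ^ᶜ B) ++ kind (n + 2) ∷ []
          ≡⟨ cong (λ t → (0 ^ᶜ A) ++ 1 ∷ (0 ^ᶜ B) ++ 1 ∷ (0 ^ᶜ B) ++ kind t ∷ []) (+-comm n 2) ⟩
        ψ 0             ∎
        where open ≡-Reasoning

  shape-A : shape A ≡ 1
  shape-A = !-at-block A 1 _

  shape-A₁ : shape A₁ ≡ 1
  shape-A₁ = trans (!-past-block A 1 _ B) (!-at-block B 1 _)

  ψ-Z : ∀ n → ψ n ! Z ≡ n + 2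
  ψ-Z n = trans (!-past-block A 1 _ (suc B + B)) (trans (!-past-block B 1 _ B) (!-at-block B (n + 2) []))

  shape-Z : shape Z ≡ 2
  shape-Z = ψ-Z 0

  marks : ∀ r → shape r ≢ 0 → r ≡ A ⊎ r ≡ A₁ ⊎ r ≡ Z
  marks r nz with block-nonzero A 1 _ r nz
  ... | inj₁ r≡A = inj₁ r≡A
  ... | inj₂ (r′ , refl , nz′) with block-nonzero B 1 _ r′ nz′
  ...   | inj₁ refl = inj₂ (inj₁ refl)
  ...   | inj₂ (r″ , refl , nz″) with block-nonzero B 2 [] r″ nz″
  ...     | inj₁ refl = inj₂ (inj₂ refl)
  ...     | inj₂ (_ , _ , nz‴) = ⊥-elim (nz‴ refl)

  shape≡1 : ∀ {r} → shape r ≡ 1 → r ≡ A ⊎ r ≡ A₁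
  shape≡1 {r} s≡1 with marks r (λ s≡0 → 1+n≢0 (trans (sym s≡1) s≡0))
  ... | inj₁ r≡A = inj₁ r≡A
  ... | inj₂ (inj₁ r≡A₁) = inj₂ r≡A₁
  ... | inj₂ (inj₂ refl) = ⊥-elim (1+n≢n (trans (sym shape-Z) s≡1))

  shape≡2 : ∀ {r} → shape r ≡ 2 → r ≡ Z
  shape≡2 {r} s≡2 with marks r (λ s≡0 → 1+n≢0 (trans (sym s≡2) s≡0))
  ... | inj₁ refl = ⊥-elim (1+n≢n (trans (sym s≡2) shape-A))
  ... | inj₂ (inj₁ refl) = ⊥-elim (1+n≢n (trans (sym s≡2) shape-A₁))
  ... | inj₂ (inj₂ r≡Z) = r≡Z

  kindAt : ℕ → ℕ
  kindAt m = shape (m % a)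

  kindAt-residue : ∀ m i → kindAt (m + i) ≡ kindAt (m % a + i)
  kindAt-residue m i = cong shape (%-shift m i a)

  kind-image : ∀ w {m} → m < length w * a → kind (apply ψ w ! m) ≡ kindAt m
  kind-image w {m} m< =
    trans (cong kind (apply-!-residue ψ-uniform w m<)) (kind-ψ (w ! (m / a)) (m % a))

  occurrence-bound : ∀ {w} p x s → apply ψ w ≡ p ++ x ++ s → ∀ {i} → i < length x →
                     length p + i < length w * a
  occurrence-bound {w} p x s occ i< = <-≤-trans (+-monoʳ-< (length p) i<)
    (subst (length p + length x ≤_) (apply-length ψ-uniform w) (occurrence-length p x s occ))

  kind-occurrence : ∀ {w} p x s → apply ψ w ≡ p ++ x ++ s → ∀ {i} → i < length x →
                    kind (x ! i) ≡ kindAt (length p + i)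
  kind-occurrence {w} p x s occ i< =
    trans (cong kind (sym (occurrence-! p x s occ i<))) (kind-image w (occurrence-bound {w} p x s occ i<))

  A<A₁ : A < A₁
  A<A₁ = s≤s (m≤m+n A B)

  B<A₁ : B < A₁
  B<A₁ = s≤s (m≤n+m B A)

  Z<a : Z < a
  Z<a = subst (Z <_) (sym a≡1+Z) (n<1+n Z)

  A₁<a : A₁ < a
  A₁<a = <-trans (+-monoʳ-< (suc A) (s≤s (m≤m+n B B))) Z<a

  A<a : A < a
  A<a = <-trans A<A₁ A₁<a

  A₁<L : A₁ < L
  A₁<L = <-witness 0 (lemma E g)
    where
      lemma : ∀ E g → let d = suc (suc (E + g)) in suc (d + g) + (d + E) + 1 ≡ 3 * d
      lemma = solve-∀

  -- Two positions whose windows of length L have the same kinds lie in the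
  -- same residue class modulo a: from a residue beyond B the mark 2 is within reach,
  -- and two residues ≤ B are told apart by the second 1.
  SameWindow : ℕ → ℕ → ℕ → Set
  SameWindow ℓ m₁ m₂ = ∀ i → i < ℓ → kindAt (m₁ + i) ≡ kindAt (m₂ + i)

  reach-Z : ∀ {r} → B < r → r < a → ∃ λ s → s < L × r + s ≡ Z
  reach-Z {r} B<r r<a with m≤n⇒∃[o]m+o≡n (≤-pred (subst (r <_) a≡1+Z r<a))
  ... | s , r+s≡Z = s , +-cancelˡ-< (suc B) s L s<L , r+s≡Z
    where
      open ≤-Reasoning
      lemma : ∀ E g → let d = suc (suc (E + g)) in
              suc (d + g) + (suc (d + E) + (d + E)) + 1 ≡ suc (d + E) + 3 * d
      lemma = solve-∀
      s<L : suc B + s < suc B + L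
      s<L = begin-strict
        suc B + s  ≤⟨ +-monoˡ-≤ s B<r ⟩
        r + s      ≡⟨ r+s≡Z ⟩
        Z          <⟨ <-witness 0 (lemma E g) ⟩
        suc B + L  ∎

  residues-via-Z : ∀ {r₁ r₂ s} → r₁ < a → r₂ < a → r₁ + s ≡ Z → kindAt (r₁ + s) ≡ kindAt (r₂ + s) →
                   r₁ ≡ r₂
  residues-via-Z {r₁} {r₂} {s} r₁<a r₂<a r₁+s≡Z same =
    residue-cancel s a r₁<a r₂<a (trans at-Z (sym (shape≡2 two)))
    where
      at-Z : (r₁ + s) % a ≡ Z
      at-Z = trans (cong (_% a) r₁+s≡Z) (m<n⇒m%n≡m Z<a)
      two : shape ((r₂ + s) % a) ≡ 2
      two = trans (sym same) (trans (cong shape at-Z) shape-Z)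

  early-residues : ∀ {r₁ r₂} → r₁ < r₂ → r₂ ≤ B → ¬ SameWindow L r₁ r₂
  early-residues {r₁} {r₂} r₁<r₂ r₂≤B same
    with m≤n⇒∃[o]m+o≡n (<⇒≤ (<-≤-trans r₁<r₂ (≤-trans r₂≤B (<⇒≤ B<A₁))))
  ... | i , r₁+i≡A₁ = not-a-one (shape≡1 one)
    where
      i<L : i < L
      i<L = ≤-<-trans (subst (i ≤_) r₁+i≡A₁ (m≤n+m i r₁)) A₁<L
      beyond : A₁ < r₂ + i
      beyond = subst (_< r₂ + i) r₁+i≡A₁ (+-monoˡ-< i r₁<r₂)
      inside : r₂ + i < a
      inside = begin-strict
        r₂ + i  ≤⟨ +-mono-≤ r₂≤B (subst (i ≤_) r₁+i≡A₁ (m≤n+m i r₁)) ⟩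
        B + A₁  <⟨ <-witness 1 (lemma A B) ⟩
        suc Z   ≡⟨ sym a≡1+Z ⟩
        a       ∎
        where
          open ≤-Reasoning
          lemma : ∀ A B → B + suc (A + B) + 2 ≡ suc (suc A + (suc B + B))
          lemma = solve-∀
      one : shape (r₂ + i) ≡ 1
      one = begin
        shape (r₂ + i)        ≡⟨ cong shape (sym (m<n⇒m%n≡m inside)) ⟩
        kindAt (r₂ + i)       ≡⟨ sym (same i i<L) ⟩
        kindAt (r₁ + i)       ≡⟨ cong (λ t → shape (t % a)) r₁+i≡A₁ ⟩
        shape (A₁ % a)        ≡⟨ cong shape (m<n⇒m%n≡m A₁<a) ⟩
        shape A₁              ≡⟨ shape-A₁ ⟩
        1                     ∎
        where open ≡-Reasoning
      not-a-one : r₂ + i ≡ A ⊎ r₂ + i ≡ A₁ → ⊥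
      not-a-one (inj₁ ≡A) = <⇒≢ (<-trans A<A₁ beyond) (sym ≡A)
      not-a-one (inj₂ ≡A₁) = <⇒≢ beyond (sym ≡A₁)

  residue-window : ∀ {r₁ r₂} → r₁ < a → r₂ < a → SameWindow L r₁ r₂ → r₁ ≡ r₂
  residue-window {r₁} {r₂} r₁<a r₂<a same with B <? r₁ | B <? r₂
  ... | yes B<r₁ | _ = let (s , s<L , r₁+s≡Z) = reach-Z B<r₁ r₁<a
                       in residues-via-Z r₁<a r₂<a r₁+s≡Z (same s s<L)
  ... | no _ | yes B<r₂ = let (s , s<L , r₂+s≡Z) = reach-Z B<r₂ r₂<a
                          in sym (residues-via-Z r₂<a r₁<a r₂+s≡Z (sym (same s s<L)))
  ... | no r₁≯B | no r₂≯B with <-cmp r₁ r₂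
  ...   | tri< r₁<r₂ _ _ = ⊥-elim (early-residues r₁<r₂ (≮⇒≥ r₂≯B) same)
  ...   | tri≈ _ r₁≡r₂ _ = r₁≡r₂
  ...   | tri> _ _ r₂<r₁ = ⊥-elim (early-residues r₂<r₁ (≮⇒≥ r₁≯B) (λ i i<L → sym (same i i<L)))

  window-residue : ∀ {m₁ m₂} → SameWindow L m₁ m₂ → m₁ % a ≡ m₂ % a
  window-residue {m₁} {m₂} same = residue-window (m%n<n m₁ a) (m%n<n m₂ a)
    (λ i i<L → trans (sym (kindAt-residue m₁ i)) (trans (same i i<L) (kindAt-residue m₂ i)))

  Fits : Word → ℕ → Set
  Fits x r = ∀ i → i < L → kind (x ! i) ≡ kindAt (r + i)

  fits-residue : ∀ {x r₁ r₂} → Fits x r₁ → Fits x r₂ → r₁ % a ≡ r₂ % a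
  fits-residue {x} {r₁} {r₂} fits₁ fits₂ =
    window-residue {r₁} {r₂} (λ i i<L → trans (sym (fits₁ i i<L)) (fits₂ i i<L))

  occurrence-fits : ∀ {w : Word} p x s → apply ψ w ≡ p ++ x ++ s → length x ≡ L → Fits x (length p)
  occurrence-fits {w} p x s occ |x| i i<L = kind-occurrence {w} p x s occ (subst (i <_) (sym |x|) i<L)

  fits-mod : ∀ {x r} → Fits x r → Fits x (r % a)
  fits-mod {x} {r} fits i i<L = trans (fits i i<L) (kindAt-residue r i)

  -- Fits with residue and window position ranging over Fin, hence decidable
  FitsFin : Word → Fin a → Set
  FitsFin x r = ∀ (i : Fin L) → kind (x ! toℕ i) ≡ kindAt (toℕ r + toℕ i)

  fitsFin⇒fits : ∀ {x r} → FitsFin x r → Fits x (toℕ r)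
  fitsFin⇒fits {x} {r} fits i i<L =
    subst (λ j → kind (x ! j) ≡ kindAt (toℕ r + j)) (toℕ-fromℕ< i<L) (fits (fromℕ< i<L))

  fits⇒fitsFin : ∀ {x r} (r<a : r < a) → Fits x r → FitsFin x (fromℕ< r<a)
  fits⇒fitsFin {x} r<a fits i =
    subst (λ t → kind (x ! toℕ i) ≡ kindAt (t + toℕ i)) (sym (toℕ-fromℕ< r<a)) (fits (toℕ i) (toℕ<n i))

  -- Either x fits at some residue r < a, which then is the residue of every
  -- occurrence, or x fits nowhere and so does not occur in any image.
  ψ-locates : Locates a ψ L
  ψ-locates x |x| with any? (λ r → all? (λ (i : Fin L) → kind (x ! toℕ i) ≟ kindAt (toℕ r + toℕ i)))
  ... | yes (r , fits) = toℕ r , λ w p s occ →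
          fits-residue {x} {length p} {toℕ r} (occurrence-fits {w} p x s occ |x|) (fitsFin⇒fits {x} {r} fits)
  ... | no fits-nowhere = 0 , λ w p s occ → ⊥-elim (fits-nowhere
          (fromℕ< (m%n<n (length p) a) , fits⇒fitsFin {x} {length p % a} (m%n<n (length p) a)
            (fits-mod {x} {length p} (occurrence-fits {w} p x s occ |x|))))

  -- Every 2d consecutive positions contain a mark, and two equal marks
  -- are at cyclic distance 0, B + 1 (from the first 1 to the second) or L (back).
  -- Hence no factor of an image repeats its kinds with period D over D letters when
  -- d ≤ D < a and D ∉ {B + 1, L}; this covers D = d and D = 2d.
  g<d : g < d
  g<d = s≤s (m≤n⇒m≤1+n (m≤n+m g E))

  E<d : E < d
  E<d = s≤s (m≤n⇒m≤1+n (m≤m+n E g))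

  d<1+B : d < suc B
  d<1+B = s≤s (m≤m+n d E)

  1+B<2d : suc B < 2 * d
  1+B<2d = <-witness g (lemma E g)
    where
      lemma : ∀ E g → let d = suc (suc (E + g)) in suc (d + E) + suc g ≡ 2 * d
      lemma = solve-∀

  2d<L : 2 * d < L
  2d<L = <-witness (suc (E + g)) (lemma E g)
    where
      lemma : ∀ E g → let d = suc (suc (E + g)) in 2 * d + suc (suc (E + g)) ≡ 3 * d
      lemma = solve-∀

  L<a : L < a
  L<a = <-witness B (lemma d E)
    where
      lemma : ∀ d E → 3 * d + suc (d + E) ≡ 3 * d + suc E + d
      lemma = solve-∀

  reach-mark : ∀ m {j t} → m % a + j ≡ t → t < a → kindAt (m + j) ≡ shape t
  reach-mark m {j} m%a+j≡t t<a =
    trans (kindAt-residue m j) (cong shape (trans (cong (_% a) m%a+j≡t) (m<n⇒m%n≡m t<a)))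

  -- a mark t ahead of the residue of m, at distance below 2d, is seen from m;
  -- as the gaps A, B, B between marks are below 2d, such a mark always exists
  mark-ahead : ∀ m {t} → m % a ≤ t → t < a → shape t ≢ 0 →
               (∀ {j} → m % a + j ≡ t → j < d + d) → ∃ λ j → j < d + d × kindAt (m + j) ≢ 0
  mark-ahead m r≤t t<a mark close = let (j , r+j≡t) = m≤n⇒∃[o]m+o≡n r≤t in
    j , close r+j≡t , λ seen≡0 → mark (trans (sym (reach-mark m r+j≡t t<a)) seen≡0)

  next-mark : ∀ m → ∃ λ j → j < d + d × kindAt (m + j) ≢ 0
  next-mark m with m % a ≤? A | m % a ≤? A₁
  ... | yes r≤A | _ = mark-ahead m r≤A A<a (λ s≡0 → 1+n≢0 (trans (sym shape-A) s≡0))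
      λ {j} r+j≡A → ≤-<-trans (subst (j ≤_) r+j≡A (m≤n+m j (m % a))) (+-monoʳ-< d g<d)
  ... | no r≰A | yes r≤A₁ = mark-ahead m r≤A₁ A₁<a (λ s≡0 → 1+n≢0 (trans (sym shape-A₁) s≡0))
      λ {j} r+j≡A₁ → ≤-<-trans (+-cancelˡ-≤ (suc A) j B (subst (suc A + j ≤_) r+j≡A₁ (+-monoˡ-≤ j (≰⇒> r≰A))))
                               (+-monoʳ-< d E<d)
  ... | _ | no r≰A₁ = mark-ahead m (≤-pred (subst (m % a <_) a≡1+Z (m%n<n m a))) Z<a
        (λ s≡0 → 1+n≢0 (trans (sym shape-Z) s≡0))
      λ {j} r+j≡Z → ≤-<-trans (+-cancelˡ-≤ (suc A₁) j B
                                 (subst (suc A₁ + j ≤_) (trans r+j≡Z (Z≡ A B)) (+-monoˡ-≤ j (≰⇒> r≰A₁))))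
                              (+-monoʳ-< d E<d)
    where
      Z≡ : ∀ A B → suc A + (suc B + B) ≡ suc (suc A + B) + B
      Z≡ = solve-∀

  no-shift : ∀ {r} → r < a → (r + 0) % a ≡ r
  no-shift {r} r<a = trans (cong (_% a) (+-identityʳ r)) (m<n⇒m%n≡m r<a)

  distance : ∀ r {D e} → D < a → e < a → (r + D) % a ≡ (r + e) % a → D ≡ e
  distance r {D} {e} D<a e<a eq =
    residue-cancel r a D<a e<a (trans (cong (_% a) (+-comm D r)) (trans eq (cong (_% a) (+-comm r e))))

  mark-distances : ∀ {r D} → D < a → shape r ≢ 0 → shape ((r + D) % a) ≡ shape r →
                   D ≡ 0 ⊎ D ≡ suc B ⊎ D ≡ L
  mark-distances {r} {D} D<a mark same with marks r mark
  ... | inj₂ (inj₂ refl) =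
    inj₁ (distance Z D<a (s≤s z≤n) (trans (shape≡2 (trans same shape-Z)) (sym (no-shift Z<a))))
  ... | inj₁ refl with shape≡1 (trans same shape-A)
  ...   | inj₁ to-A = inj₁ (distance A D<a (s≤s z≤n) (trans to-A (sym (no-shift A<a))))
  ...   | inj₂ to-A₁ = inj₂ (inj₁ (distance A D<a (≤-<-trans B<A₁ A₁<a)
                          (trans to-A₁ (sym (trans (cong (_% a) (+-suc A B)) (m<n⇒m%n≡m A₁<a))))))
  mark-distances {r} {D} D<a mark same | inj₂ (inj₁ refl) with shape≡1 (trans same shape-A₁)
  ...   | inj₁ to-A = inj₂ (inj₂ (distance A₁ D<a L<a (trans to-A (sym back))))
    where
      back : (A₁ + L) % a ≡ A
      back = trans (cong (_% a) (lemma E g)) (trans ([m+n]%n≡m%n A a) (m<n⇒m%n≡m A<a))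
        where
          lemma : ∀ E g → let d = suc (suc (E + g)) in
                  suc (d + g) + (d + E) + 3 * d ≡ d + g + (3 * d + suc E + d)
          lemma = solve-∀
  ...   | inj₂ to-A₁ = inj₁ (distance A₁ D<a (s≤s z≤n) (trans to-A₁ (sym (no-shift A₁<a))))

  distinct-marks : ∀ {D} → 0 < D → D < a → D ≢ suc B → D ≢ L →
                   ∀ u → kindAt u ≢ 0 → kindAt u ≢ kindAt (u + D)
  distinct-marks {D} 0<D D<a D≢1+B D≢L u mark same with mark-distances {u % a} {D} D<a mark
    (sym (trans same (kindAt-residue u D)))
  ... | inj₁ D≡0 = <⇒≢ 0<D (sym D≡0)
  ... | inj₂ (inj₁ D≡1+B) = D≢1+B D≡1+B
  ... | inj₂ (inj₂ D≡L) = D≢L D≡L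

  Repeats : ℕ → ℕ → Set
  Repeats D m = ∀ i → i < D → kindAt (m + i) ≡ kindAt (m + D + i)

  -- A mark within 2d of m lies in [m, m + D) or in [m + D, m + 2D); either way
  -- the repetition puts an equal mark at distance D from it.
  no-repetition : ∀ {D} → d ≤ D → D < a → D ≢ suc B → D ≢ L → ∀ m → ¬ Repeats D m
  no-repetition {D} d≤D D<a D≢1+B D≢L m repeats = around (next-mark m)
    where
      clash : ∀ u → kindAt u ≢ 0 → kindAt u ≢ kindAt (u + D)
      clash = distinct-marks (<-≤-trans (s≤s z≤n) d≤D) D<a D≢1+B D≢L
      rearrange : ∀ m D j → m + D + j ≡ m + j + D
      rearrange = solve-∀
      swap : ∀ j → m + D + j ≡ m + j + D
      swap = rearrange m D
      around : (∃ λ j → j < d + d × kindAt (m + j) ≢ 0) → ⊥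
      around (j , j<2d , mark) with j <? D
      ... | yes j<D = clash (m + j) mark (trans (repeats j j<D) (cong kindAt (swap j)))
      ... | no j≮D with m≤n⇒∃[o]m+o≡n (≮⇒≥ j≮D)
      ...   | j′ , refl = clash (m + j′) mark′ (trans (repeats j′ j′<D) (cong kindAt (swap j′)))
        where
          j′<D : j′ < D
          j′<D = +-cancelˡ-< D j′ D (<-≤-trans j<2d (+-mono-≤ d≤D d≤D))
          mark′ : kindAt (m + j′) ≢ 0
          mark′ ≡0 = mark (trans (cong kindAt (sym (+-assoc m D j′))) (trans (sym (repeats j′ j′<D)) ≡0))

  no-short-repetition : ∀ k → 1 ≤ k → k ≤ 2 → ∀ m → ¬ Repeats (k * d) m
  no-short-repetition 1 _ _ = subst (λ D → ∀ m → ¬ Repeats D m) (sym (*-identityˡ d))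
    (no-repetition ≤-refl (<-trans (<-trans (<-trans d<1+B 1+B<2d) 2d<L) L<a)
      (<⇒≢ d<1+B) (<⇒≢ (<-trans (<-trans d<1+B 1+B<2d) 2d<L)))
  no-short-repetition 2 _ _ = no-repetition (m≤n*m d 2) (<-trans 2d<L L<a) (>⇒≢ 1+B<2d) (<⇒≢ 2d<L)
  no-short-repetition (suc (suc (suc _))) _ (s≤s (s≤s ()))

  d<b : d < b
  d<b = <-witness (d + d + E) (lemma d E)
    where
      lemma : ∀ d E → d + suc (d + d + E) ≡ 3 * d + suc E
      lemma = solve-∀

  open OneAndAFraction a b d refl d<b

  kinds-repeat : ∀ {w} p X s k → apply ψ w ≡ p ++ X ++ s → length X ≡ k * a →
                 HasPeriod (k * b) (k * d) X →
                 ∀ i → i < k * d → kindAt (length p + i) ≡ kindAt (length p + k * b + i)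
  kinds-repeat {w} p X s k occ |X| period i i<kd = begin
    kindAt (length p + i)           ≡⟨ sym (kind-occurrence {w} p X s occ i<|X|) ⟩
    kind (X ! i)                    ≡⟨ cong kind (period i i<kd) ⟩
    kind (X ! (k * b + i))          ≡⟨ kind-occurrence {w} p X s occ kb+i<|X| ⟩
    kindAt (length p + (k * b + i)) ≡⟨ cong kindAt (sym (+-assoc (length p) (k * b) i)) ⟩
    kindAt (length p + k * b + i)   ∎
    where
      open ≡-Reasoning
      kb+i<|X| : k * b + i < length X
      kb+i<|X| = subst (k * b + i <_) (sym (trans |X| (ka≡kb+kd k))) (+-monoʳ-< (k * b) i<kd)
      i<|X| : i < length X
      i<|X| = ≤-<-trans (m≤n+m i (k * b)) kb+i<|X|

  -- For k ∈ {1, 2} this is a repetition of period k·d at q + k·b, since k·b + k·d = k·a.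
  no-short-power : ∀ {w} p X s k → 1 ≤ k → k ≤ 2 → apply ψ w ≡ p ++ X ++ s → length X ≡ k * a →
                   ¬ HasPeriod (k * b) (k * d) X
  no-short-power {w} p X s k 1≤k k≤2 occ |X| period =
    no-short-repetition k 1≤k k≤2 (length p + k * b) λ i i<kd → begin
      kindAt (length p + k * b + i)          ≡⟨ sym (kinds-repeat {w} p X s k occ |X| period i i<kd) ⟩
      kindAt (length p + i)                  ≡⟨ cong shape (sym ([m+kn]%n≡m%n (length p + i) k a)) ⟩
      kindAt (length p + i + k * a)
        ≡⟨ cong kindAt (lemma (length p) (k * b) (k * d) i (k * a) (ka≡kb+kd k)) ⟩
      kindAt (length p + k * b + k * d + i)  ∎
    where
      open ≡-Reasoning
      lemma : ∀ q x y i z → z ≡ x + y → q + i + z ≡ q + x + y + i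
      lemma q x y i z refl = rearrange q x y i
        where
          rearrange : ∀ q x y i → q + i + (x + y) ≡ q + x + y + i
          rearrange = solve-∀

  -- For k ≥ 3 the repetition covers a window of length L = 3d, so q and q + k·b have
  -- the same residue; thus a ∣ k·b, and a ∣ k as a and b are coprime.
  long-power-aligned : ∀ {w} p X s k → Coprime a b → 3 ≤ k → apply ψ w ≡ p ++ X ++ s →
                       length X ≡ k * a → HasPeriod (k * b) (k * d) X → a ∣ k
  long-power-aligned {w} p X s k coprime 3≤k occ |X| period =
    coprime-divisor coprime (subst (a ∣_) (*-comm k b) a∣kb)
    where
      q : ℕ
      q = length p
      same-residue : q % a ≡ (q + k * b) % a
      same-residue = window-residue {q} {q + k * b} (λ i i<L →
        kinds-repeat {w} p X s k occ |X| period i (<-≤-trans i<L (*-monoˡ-≤ d 3≤k)))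
      kb%a≡0 : (k * b) % a ≡ 0
      kb%a≡0 = sym (%-cancelʳ-+ 0 (k * b) q a (trans same-residue (cong (_% a) (+-comm q (k * b)))))
      a∣kb : a ∣ k * b
      a∣kb = m%n≡0⇒n∣m (k * b) a kb%a≡0

  block-letter : ∀ w j → j * a + Z < length w * a → apply ψ w ! (j * a + Z) ≡ w ! j + 2
  block-letter w j bound = trans (apply-! ψ-uniform w j Z<a bound) (ψ-Z (w ! j))

  -- The last letters of the blocks J + i met by X
  -- show that the factor of w of length t·a at J is periodic, hence an a/b-power.
  module Lift {w : Word} (p X s : Word) (t : ℕ) (occ : apply ψ w ≡ p ++ X ++ s)
              (|X| : length X ≡ t * a * a) (period : HasPeriod (t * a * b) (t * a * d) X) where

    q J : ℕ
    q = length p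
    J = q / a

    block-end : ∃ λ c → q % a + c ≡ Z
    block-end = m≤n⇒∃[o]m+o≡n (≤-pred (subst (q % a <_) a≡1+Z (m%n<n q a)))

    c : ℕ
    c = proj₁ block-end

    q%a+c≡Z : q % a + c ≡ Z
    q%a+c≡Z = proj₂ block-end

    letter-at : ∀ {j o} → o < length X → q + o ≡ j * a + Z → X ! o ≡ w ! j + 2
    letter-at {j} {o} o<|X| q+o≡ = begin
      X ! o                     ≡⟨ sym (occurrence-! p X s occ o<|X|) ⟩
      apply ψ w ! (q + o)       ≡⟨ cong (apply ψ w !_) q+o≡ ⟩
      apply ψ w ! (j * a + Z)
        ≡⟨ block-letter w j (subst (_< length w * a) q+o≡ (occurrence-bound {w} p X s occ o<|X|)) ⟩
      w ! j + 2                 ∎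
      where open ≡-Reasoning

    offset : ℕ → ℕ
    offset i = i * a + c

    offset-bound : ∀ {i} → i < t * d → offset i < t * a * d
    offset-bound {i} i<td = begin-strict
      i * a + c    <⟨ +-monoʳ-< (i * a) (≤-<-trans (subst (c ≤_) q%a+c≡Z (m≤n+m c (q % a))) Z<a) ⟩
      i * a + a    ≡⟨ +-comm (i * a) a ⟩
      suc i * a    ≤⟨ *-monoˡ-≤ a i<td ⟩
      t * d * a    ≡⟨ lemma t d a ⟩
      t * a * d    ∎
      where
        open ≤-Reasoning
        lemma : ∀ t d a → t * d * a ≡ t * a * d
        lemma = solve-∀

    q≡ : q ≡ q % a + J * a
    q≡ = m≡m%n+[m/n]*n q a

    offset-position : ∀ i → q + offset i ≡ (J + i) * a + Z
    offset-position i = begin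
      q + (i * a + c)                      ≡⟨ cong (_+ (i * a + c)) q≡ ⟩
      q % a + J * a + (i * a + c)          ≡⟨ lemma (q % a) J a i c ⟩
      (J + i) * a + (q % a + c)            ≡⟨ cong ((J + i) * a +_) q%a+c≡Z ⟩
      (J + i) * a + Z                      ∎
      where
        open ≡-Reasoning
        lemma : ∀ ρ J a i c → ρ + J * a + (i * a + c) ≡ (J + i) * a + (ρ + c)
        lemma = solve-∀

    shifted-position : ∀ i → q + (t * a * b + offset i) ≡ (J + (t * b + i)) * a + Z
    shifted-position i = begin
      q + (t * a * b + (i * a + c))               ≡⟨ cong (_+ (t * a * b + (i * a + c))) q≡ ⟩
      q % a + J * a + (t * a * b + (i * a + c))   ≡⟨ lemma (q % a) J a i c t b ⟩
      (J + (t * b + i)) * a + (q % a + c)         ≡⟨ cong ((J + (t * b + i)) * a +_) q%a+c≡Z ⟩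
      (J + (t * b + i)) * a + Z                   ∎
      where
        open ≡-Reasoning
        lemma : ∀ ρ J a i c t b → ρ + J * a + (t * a * b + (i * a + c)) ≡ (J + (t * b + i)) * a + (ρ + c)
        lemma = solve-∀

    preimage-period : HasPeriod (t * b) (t * d) (take (t * a) (drop J w))
    preimage-period i i<td = begin
      take (t * a) (drop J w) ! i            ≡⟨ !-window J (t * a) w i<ta ⟩
      w ! (J + i)                            ≡⟨ +-cancelʳ-≡ 2 _ _ recorded ⟩
      w ! (J + (t * b + i))                  ≡⟨ sym (!-window J (t * a) w tb+i<ta) ⟩
      take (t * a) (drop J w) ! (t * b + i)  ∎
      where
        open ≡-Reasoning
        tb+i<ta : t * b + i < t * a
        tb+i<ta = subst (t * b + i <_) (sym (ka≡kb+kd t)) (+-monoʳ-< (t * b) i<td)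
        i<ta : i < t * a
        i<ta = ≤-<-trans (m≤n+m i (t * b)) tb+i<ta
        shifted<|X| : t * a * b + offset i < length X
        shifted<|X| = subst (t * a * b + offset i <_) (sym (trans |X| (ka≡kb+kd (t * a))))
                            (+-monoʳ-< (t * a * b) (offset-bound i<td))
        offset<|X| : offset i < length X
        offset<|X| = ≤-<-trans (m≤n+m (offset i) (t * a * b)) shifted<|X|
        recorded : w ! (J + i) + 2 ≡ w ! (J + (t * b + i)) + 2
        recorded = trans (sym (letter-at offset<|X| (offset-position i)))
                         (trans (period (offset i) (offset-bound i<td))
                                (letter-at shifted<|X| (shifted-position i)))

    room : J + t * a ≤ length w
    room = *-cancelʳ-≤ (J + t * a) (length w) a (begin
      (J + t * a) * a       ≡⟨ *-distribʳ-+ a J (t * a) ⟩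
      J * a + t * a * a     ≤⟨ +-mono-≤ (m/n*n≤m q a) (≤-reflexive (sym |X|)) ⟩
      q + length X          ≤⟨ occurrence-length p X s occ ⟩
      length (apply ψ w)    ≡⟨ apply-length ψ-uniform w ⟩
      length w * a          ∎)
      where open ≤-Reasoning

    lifted-power : t ≢ 0 → ¬ PowerFree a b w
    lifted-power t≢0 w-free = w-free (take (t * a) (drop J w)) (window-factor J (t * a) w)
      (periodic⇒power t t≢0 (length-window J (t * a) w room) preimage-period)

  -- A power in ψ(w) has period k·b for some k ≥ 1: k ≤ 2 is impossible, and for
  -- k ≥ 3 we have k = t·a and the power lifts to a power in w.
  ψ-power-free : Coprime a b → MorphismPowerFree a b ψ
  ψ-power-free coprime w w-free X (p , s , occ) X-power with power⇒periodic X-power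
  ... | k , k≢0 , |X| , period with k ≤? 2
  ...   | yes k≤2 = no-short-power {w} p X s k (n≢0⇒n>0 k≢0) k≤2 occ |X| period
  ...   | no k≰2 with long-power-aligned {w} p X s k coprime (≰⇒> k≰2) occ |X| period
  ...     | divides t refl = Lift.lifted-power {w} p X s t occ |X| period t≢0 w-free
    where
      t≢0 : t ≢ 0
      t≢0 refl = k≢0 refl

  φab≡ψ : ∀ n → φab a b n ≡ ψ n
  φab≡ψ n = cong₂ (λ x y → (0 ^ᶜ x) ++ (1 ∷ []) ++ (0 ^ᶜ y) ++ (1 ∷ []) ++ (0 ^ᶜ y) ++ (n + 2 ∷ []))
                  (cong (_∸ 1) (exponent (5 * a) (6 * b) (suc A) (lemma₁ E g)))
                  (cong (_∸ 1) (exponent (3 * b) (2 * a) (suc B) (lemma₂ E g)))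
    where
      exponent : ∀ m n k → m ≡ n + k → m ∸ n ≡ k
      exponent _ n k refl = m+n∸m≡n n k
      lemma₁ : ∀ E g → let d = suc (suc (E + g)) in 5 * (3 * d + suc E + d) ≡ 6 * (3 * d + suc E) + suc (d + g)
      lemma₁ = solve-∀
      lemma₂ : ∀ E g → let d = suc (suc (E + g)) in 3 * (3 * d + suc E) ≡ 2 * (3 * d + suc E + d) + suc (d + E)
      lemma₂ = solve-∀

  L≡ : 3 * a ∸ 3 * b ≡ L
  L≡ = trans (cong (_∸ 3 * b) (*-distribˡ-+ 3 b d)) (m+n∸m≡n (3 * b) (3 * d))

module _ {φ φ′ : Morphism} (same : ∀ n → φ n ≡ φ′ n) where

  locates-cong : ∀ k .{{_ : NonZero k}} ℓ → Locates k φ′ ℓ → Locates k φ ℓ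
  locates-cong k ℓ locates x |x| = proj₁ (locates x |x|) ,
    λ w p s occ → proj₂ (locates x |x|) w p s (trans (sym (concatMap-cong same w)) occ)

  power-free-cong : ∀ a b .{{_ : NonZero b}} → MorphismPowerFree a b φ′ → MorphismPowerFree a b φ
  power-free-cong a b power-free w w-free =
    subst (PowerFree a b) (sym (concatMap-cong same w)) (power-free w w-free)

module Parameters where

  b≤a : ∀ {a b} → 5 * b < 4 * a → b ≤ a
  b≤a {a} {b} 5b<4a = ≮⇒≥ λ a<b → <-asym 5b<4a (<-≤-trans (*-monoʳ-< 4 a<b) (*-monoˡ-≤ b (n≤1+n 4)))

  3d<b : ∀ {b d} → 3 * (b + d) < 4 * b → 3 * d < b
  3d<b {b} {d} 3a<4b = +-cancelˡ-< (3 * b) (3 * d) b (subst₂ _<_ (*-distribˡ-+ 3 b d) (lemma b) 3a<4b)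
    where
      lemma : ∀ b → 4 * b ≡ 3 * b + b
      lemma = solve-∀

  b<4d : ∀ {b d} → 5 * b < 4 * (b + d) → b < 4 * d
  b<4d {b} {d} 5b<4a = +-cancelˡ-< (4 * b) b (4 * d) (subst₂ _<_ (lemma b) (*-distribˡ-+ 4 b d) 5b<4a)
    where
      lemma : ∀ b → 5 * b ≡ 4 * b + b
      lemma = solve-∀

  2+E≤d : ∀ {d E} → suc (3 * d) + E < 4 * d → suc (suc E) ≤ d
  2+E≤d {d} {E} b<4d = +-cancelˡ-≤ (3 * d) (suc (suc E)) d (subst₂ _≤_ (lemma₁ d E) (lemma₂ d) b<4d)
    where
      lemma₁ : ∀ d E → suc (suc (3 * d) + E) ≡ 3 * d + suc (suc E)
      lemma₁ = solve-∀
      lemma₂ : ∀ d → 4 * d ≡ 3 * d + d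
      lemma₂ = solve-∀

  parameters : ∀ a b → 5 * b < 4 * a → 3 * a < 4 * b → ∃₂ λ E g → a ≡ Pattern.a E g × b ≡ Pattern.b E g
  parameters a b 5b<4a 3a<4b with m≤n⇒∃[o]m+o≡n {b} {a} (b≤a 5b<4a)
  ... | d , refl with m≤n⇒∃[o]m+o≡n {suc (3 * d)} {b} (3d<b 3a<4b)
  ...   | E , refl with m≤n⇒∃[o]m+o≡n {suc (suc E)} {d} (2+E≤d (b<4d 5b<4a))
  ...     | g , refl = E , g , lemma₁ E g , lemma₂ E g
    where
      lemma₁ : ∀ E g → suc (3 * (suc (suc E) + g)) + E + (suc (suc E) + g)
                       ≡ 3 * suc (suc (E + g)) + suc E + suc (suc (E + g))
      lemma₁ = solve-∀
      lemma₂ : ∀ E g → suc (3 * (suc (suc E) + g)) + E ≡ 3 * suc (suc (E + g)) + suc E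
      lemma₂ = solve-∀

theorem4p6 : (a b : ℕ) → .{{_ : NonZero a}} → .{{_ : NonZero b}} →
    Coprime a b → 5 * b < 4 * a → 3 * a < 4 * b →
    Locates a (φab a b) (3 * a ∸ 3 * b) × MorphismPowerFree a b (φab a b)
theorem4p6 a b coprime 5b<4a 3a<4b with Parameters.parameters a b 5b<4a 3a<4b
... | E , g , refl , refl =
  subst (Locates P.a (φab P.a P.b)) (sym P.L≡) (locates-cong P.φab≡ψ P.a P.L P.ψ-locates) ,
  power-free-cong P.φab≡ψ P.a P.b (P.ψ-power-free coprime)
  where module P = Pattern E g
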